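{- For integers $r\ge s\ge 0$ with $r\ge 1$, $$b_{(r,s)}(q)=\begin{cases}\sum_{i=0}^{s} f_{(r+i,s-i)}\,q^i & \text{if } r>s,\\ \sum_{i=0}^{s-1} f_{(r+i,s-1-i)}\,q^i & \text{if } r=s.\end{cases}$$
   Context: For integers $a\ge b\ge 0$, $f_{(a,b)}$ is the number of standard tableaux of shape $(a,b)$ (shape $(a)$ when $b=0$). For a standard tableau $T$ of shape $\lambda$ (filling by $1,\dots,|\lambda|$ with rows and columns increasing) and $2\le j\le\lambda_i$, $c_{ij}(T)=\#\{i'\ge i:\text{cell }(i',j-1)\text{ exists and }T_{i',j-1}<T_{ij}\}$, $c_q(T)=\prod_i\prod_{j=2}^{\lambda_i}[c_{ij}(T)]_q$ with $[a]_q=1+q+\dots+q^{a-1}$, and $b_\lambda(q)=\sum_T c_q(T)$ over standard tableaux of shape $\lambda$; $b_{(r,0)}$ means $b_{(r)}$. -}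

module Defs where

open import Data.Nat using (ℕ; zero; suc; _+_; _*_; _∸_; _<ᵇ_; _≡ᵇ_)
open import Data.Bool using (Bool; true; false; _∧_; not; if_then_else_)
open import Data.Fin using (Fin; toℕ)
open import Data.Vec using (Vec; []; _∷_; toList)
open import Data.List using (List; []; _∷_; [_]; map; concatMap; filter; length; zipWith; _++_; cartesianProduct; foldr; upTo)
open import Data.List as L using ()
open import Data.Fin using (Fin)
open import Data.List using (allFin)
open import Data.Product using (_×_; _,_; proj₁; proj₂)
open import Relation.Nullary.Decidable using (isYes)
open import Relation.Binary.PropositionalEquality using (_≡_)
open import Data.Bool using (_≟_)
open import Data.Bool.ListAction using (any)

-- Polynomials in q with ℕ coefficients, represented by their
-- coefficient function: p k = coefficient of q^k.

Poly : Set
Poly = ℕ → ℕ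

b2n : Bool → ℕ
b2n true  = 1
b2n false = 0

Σ< : ℕ → (ℕ → ℕ) → ℕ
Σ< zero    g = 0
Σ< (suc n) g = Σ< n g + g n

0ₚ 1ₚ : Poly
0ₚ k = 0
1ₚ k = b2n (k ≡ᵇ 0)

_+ₚ_ : Poly → Poly → Poly
(p +ₚ r) k = p k + r k

_*ₚ_ : Poly → Poly → Poly
(p *ₚ r) k = Σ< (suc k) (λ i → p i * r (k ∸ i))

mono : ℕ → ℕ → Poly
mono c i k = if k ≡ᵇ i then c else 0

-- q-integer [a]_q = 1 + q + ... + q^(a-1)
qint : ℕ → Poly
qint a k = b2n (k <ᵇ a)

prodₚ : List Poly → Poly
prodₚ = foldr _*ₚ_ 1ₚ

sumₚ : List Poly → Poly
sumₚ = foldr _+ₚ_ 0ₚ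

Σₚ< : ℕ → (ℕ → Poly) → Poly
Σₚ< zero    g = 0ₚ
Σₚ< (suc n) g = Σₚ< n g +ₚ g n

-- A filling consists of the first row
-- (a entries) and the second row (b entries), entries in {0,…,a+b-1}
-- (i.e. the labels 1,…,|λ| shifted down by one, which does not affect
-- any comparison).

Filling : ℕ → ℕ → Set
Filling a b = Vec (Fin (a + b)) a × Vec (Fin (a + b)) b

allVecs : (n m : ℕ) → List (Vec (Fin n) m)
allVecs n zero    = [ [] ]
allVecs n (suc m) = concatMap (λ x → map (x ∷_) (allVecs n m)) (allFin n)

allFillings : (a b : ℕ) → List (Filling a b)
allFillings a b = cartesianProduct (allVecs (a + b) a) (allVecs (a + b) b)

increasing : List ℕ → Bool
increasing (x ∷ y ∷ xs) = (x <ᵇ y) ∧ increasing (y ∷ xs)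
increasing _            = true

distinct : List ℕ → Bool
distinct []       = true
distinct (x ∷ xs) = not (any (x ≡ᵇ_) xs) ∧ distinct xs

colsIncreasing : List ℕ → List ℕ → Bool
colsIncreasing (x ∷ xs) (y ∷ ys) = (x <ᵇ y) ∧ colsIncreasing xs ys
colsIncreasing _        _        = true

row1 row2 : ∀ {a b} → Filling a b → List ℕ
row1 T = map toℕ (toList (proj₁ T))
row2 T = map toℕ (toList (proj₂ T))

-- standard: all a+b entries distinct (hence exactly 0,…,a+b-1, each once),
-- rows and columns strictly increasing
isStandard : ∀ {a b} → Filling a b → Bool
isStandard T = distinct (row1 T ++ row2 T)
             ∧ increasing (row1 T) ∧ increasing (row2 T)
             ∧ colsIncreasing (row1 T) (row2 T)

standardTableaux : (a b : ℕ) → List (Filling a b)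
standardTableaux a b = filter (λ T → isStandard T ≟ true) (allFillings a b)

f : ℕ → ℕ → ℕ
f a b = length (standardTableaux a b)

-- c_{ij}(T) for the cells (i,j), j ≥ 2, of a two-row tableau.
-- Row 1, cell (1,j): count i' ∈ {1,2} with (i',j-1) existing and
--   T_{i',j-1} < T_{1j}.   Arguments: row 1 starting at column j-1,
--   row 2 starting at column j-1 (empty if those cells do not exist).
cRow1 : List ℕ → List ℕ → List ℕ
cRow1 (x ∷ y ∷ xs) (z ∷ zs) = (b2n (x <ᵇ y) + b2n (z <ᵇ y)) ∷ cRow1 (y ∷ xs) zs
cRow1 (x ∷ y ∷ xs) []       = b2n (x <ᵇ y) ∷ cRow1 (y ∷ xs) []
cRow1 _            _        = []

-- Row 2, cell (2,j): only i' = 2 (there is no third row).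
cRow2 : List ℕ → List ℕ
cRow2 (x ∷ y ∷ xs) = b2n (x <ᵇ y) ∷ cRow2 (y ∷ xs)
cRow2 _            = []

cs : ∀ {a b} → Filling a b → List ℕ
cs T = cRow1 (row1 T) (row2 T) ++ cRow2 (row2 T)

cq : ∀ {a b} → Filling a b → Poly
cq T = prodₚ (map qint (cs T))

bpoly : ℕ → ℕ → Poly
bpoly a b = sumₚ (map cq (standardTableaux a b))

{-# OPTIONS --safe #-}

-- Every c_ij(T) of a two-row tableau is 1 or 2, and it is 2 exactly at a first-row cell (1, j)
-- whose lower-left neighbour (2, j - 1) exists and holds a smaller entry.  Hence
-- c_q(T) = (1 + q)^M(T) and the coefficient of q^k in b_(a,b) is the sum over T of (M(T) choose k).
-- The largest entry of T ends one of its rows.  Removing it from the second row leaves M unchanged;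
-- removing it from the first row lowers M by one if the rows then have equal nonzero length, and leaves
-- it unchanged otherwise.  So these coefficients satisfy a Pascal-type recursion in the shape,
-- as do the numbers f_(a,b) (f_(a+1,b+1) = f_(a+1,b) + f_(a,b+1) for b < a), and the closed form
-- follows by induction on the shape.
module Submission where

open import Data.Bool using (Bool; true; false; _∧_; not; if_then_else_)
open import Data.Bool.ListAction using (any)
open import Data.Bool.Properties using (T-≡) renaming (_≟_ to _≟ᵇ_)
open import Data.Empty using (⊥-elim)
open import Data.Fin using (Fin; toℕ; fromℕ<)
open import Data.Fin.Properties using (toℕ<n; toℕ-injective; toℕ-fromℕ<)
open import Data.List using (List; []; _∷_; [_]; _++_; _∷ʳ_; length; map; concatMap; allFin)
open import Data.List.Membership.Propositional using (_∈_; _∉_)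
open import Data.List.Membership.Propositional.Properties
  using (∈-∃++; ∈-++⁺ˡ; ∈-++⁺ʳ; ∈-++⁻; ∈-map⁺; ∈-map⁻; ∈-filter⁺; ∈-filter⁻; ∈-cartesianProduct⁺; ∈-allFin)
open import Data.List.Membership.Propositional.Properties.WithK using (unique∧set⇒bag)
open import Data.List.Properties
  using (++-assoc; ++-identityʳ; length-++; length-map; map-++; map-∘; map-cong-local; ∷-injective; ∷ʳ-injectiveˡ)
open import Data.List.Relation.Binary.BagAndSetEquality using (∼bag⇒↭)
open import Data.List.Relation.Binary.Permutation.Propositional using (_↭_; ↭⇒↭ₛ; ↭-reflexive; ↭-sym; ↭-trans)
open import Data.List.Relation.Binary.Permutation.Propositional.Properties
  using (All-resp-↭; shift; ↭-length; ∷↭∷ʳ) renaming (map⁺ to ↭-map⁺)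
import Data.List.Relation.Binary.Permutation.Setoid.Properties as ↭ₛ
open import Data.List.Relation.Unary.All using (All; []; _∷_; lookup)
import Data.List.Relation.Unary.All as All
open import Data.List.Relation.Unary.All.Properties using (¬Any⇒All¬; ++⁺; ++⁻ˡ; ++⁻ʳ)
open import Data.List.Relation.Unary.Any using (here; there)
open import Data.List.Relation.Unary.Unique.Propositional using (Unique; []; _∷_)
import Data.List.Relation.Unary.Unique.Propositional.Properties as Unique
open import Data.Nat using (ℕ; zero; suc; _+_; _*_; _∸_; pred; _≤_; _<_; _<ᵇ_; _≡ᵇ_; z≤n; s≤s; _≟_)
open import Data.Nat.Combinatorics using (_C_; nCk≡nC[n∸k]; nCn≡1; nCk+nC[k+1]≡[n+1]C[k+1])
open import Data.Nat.ListAction using (sum)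
open import Data.Nat.ListAction.Properties using (sum-++; sum-↭)
open import Data.Nat.Properties
open import Algebra.Properties.CommutativeSemigroup +-commutativeSemigroup using (interchange)
open import Data.List.Membership.DecPropositional _≟_ using (_∈?_)
open import Data.Product using (Σ; ∃; _×_; _,_; proj₁; proj₂)
open import Data.Sum using (_⊎_; inj₁; inj₂)
import Data.Sum as Sum
open import Data.Vec using (Vec; []; _∷_; toList; head)
open import Function using (_∘_; Equivalence; mk⇔)
open import Relation.Binary using (Tri; tri<; tri≈; tri>)
open import Relation.Binary.PropositionalEquality
  using (_≡_; _≢_; refl; sym; trans; cong; cong₂; subst; subst₂; setoid; module ≡-Reasoning)
open import Relation.Nullary using (¬_; yes; no)

open import Defs

open Equivalence using (to; from)

∧-true⁻ : ∀ {a b} → a ∧ b ≡ true → a ≡ true × b ≡ true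
∧-true⁻ {true} b≡true = refl , b≡true

∧-true⁺ : ∀ {a b} → a ≡ true → b ≡ true → a ∧ b ≡ true
∧-true⁺ refl refl = refl

<ᵇ-true⁻ : ∀ {m n} → (m <ᵇ n) ≡ true → m < n
<ᵇ-true⁻ = <ᵇ⇒< _ _ ∘ from T-≡

<ᵇ-true⁺ : ∀ {m n} → m < n → (m <ᵇ n) ≡ true
<ᵇ-true⁺ = to T-≡ ∘ <⇒<ᵇ

<ᵇ-false⁺ : ∀ {m n} → n ≤ m → (m <ᵇ n) ≡ false
<ᵇ-false⁺ {m}     {zero}  z≤n       = refl
<ᵇ-false⁺ {suc m} {suc n} (s≤s n≤m) = <ᵇ-false⁺ n≤m

≡ᵇ-refl : ∀ m → (m ≡ᵇ m) ≡ true
≡ᵇ-refl m = to T-≡ (≡⇒≡ᵇ m m refl)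

≡ᵇ-false⁺ : ∀ {m n} → m ≢ n → (m ≡ᵇ n) ≡ false
≡ᵇ-false⁺ {m} {n} m≢n with m ≡ᵇ n in eq
... | true  = ⊥-elim (m≢n (≡ᵇ⇒≡ m n (from T-≡ eq)))
... | false = refl

≡ᵇ-false⁻ : ∀ {m n} → (m ≡ᵇ n) ≡ false → m ≢ n
≡ᵇ-false⁻ {m} eq refl with () ← trans (sym (≡ᵇ-refl m)) eq

notAny-≡ᵇ⇒All≢ : ∀ x ys → not (any (x ≡ᵇ_) ys) ≡ true → All (x ≢_) ys
notAny-≡ᵇ⇒All≢ x []       _ = []
notAny-≡ᵇ⇒All≢ x (y ∷ ys) p with x ≡ᵇ y in eq
... | false = ≡ᵇ-false⁻ eq ∷ notAny-≡ᵇ⇒All≢ x ys p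

All≢⇒notAny-≡ᵇ : ∀ x ys → All (x ≢_) ys → not (any (x ≡ᵇ_) ys) ≡ true
All≢⇒notAny-≡ᵇ x []       []           = refl
All≢⇒notAny-≡ᵇ x (y ∷ ys) (x≢y ∷ x≢ys) rewrite ≡ᵇ-false⁺ x≢y = All≢⇒notAny-≡ᵇ x ys x≢ys

distinct⇒Unique : ∀ l → distinct l ≡ true → Unique l
distinct⇒Unique []      _ = []
distinct⇒Unique (x ∷ l) p with ∧-true⁻ {not (any (x ≡ᵇ_) l)} p
... | x∉l , dl = notAny-≡ᵇ⇒All≢ x l x∉l ∷ distinct⇒Unique l dl

Unique⇒distinct : ∀ l → Unique l → distinct l ≡ true
Unique⇒distinct []      []         = refl
Unique⇒distinct (x ∷ l) (x∉l ∷ ul) = ∧-true⁺ (All≢⇒notAny-≡ᵇ x l x∉l) (Unique⇒distinct l ul)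

Unique-resp-↭ : ∀ {l l′ : List ℕ} → l ↭ l′ → Unique l → Unique l′
Unique-resp-↭ = ↭ₛ.Unique-resp-↭ (setoid ℕ) ∘ ↭⇒↭ₛ

record Distinct< (n : ℕ) (l : List ℕ) : Set where
  constructor distinct<
  field
    unique  : Unique l
    bounded : All (_< n) l

open Distinct<

Distinct<-resp-↭ : ∀ {n l l′} → l ↭ l′ → Distinct< n l → Distinct< n l′
Distinct<-resp-↭ p (distinct< ul bl) = distinct< (Unique-resp-↭ p ul) (All-resp-↭ p bl)

Distinct<-max⁺ : ∀ {m l} → Distinct< m l → Distinct< (suc m) (m ∷ l)
Distinct<-max⁺ (distinct< ul bl) =
  distinct< (All.map (λ y<m m≡y → <-irrefl (sym m≡y) y<m) bl ∷ ul) (≤-refl ∷ All.map m≤n⇒m≤1+n bl)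

All<suc-≢⇒All< : ∀ {m l} → All (_< suc m) l → All (m ≢_) l → All (_< m) l
All<suc-≢⇒All< bl m≢l = All.zipWith (λ (y≤m , m≢y) → ≤∧≢⇒< (≤-pred y≤m) (m≢y ∘ sym)) (bl , m≢l)

Distinct<-max⁻ : ∀ {m l} → Distinct< (suc m) (m ∷ l) → Distinct< m l
Distinct<-max⁻ (distinct< (m∉l ∷ ul) (_ ∷ bl)) = distinct< ul (All<suc-≢⇒All< bl m∉l)

Distinct<-∉max : ∀ {m l} → m ∉ l → Distinct< (suc m) l → Distinct< m l
Distinct<-∉max {l = l} m∉l (distinct< ul bl) = distinct< ul (All<suc-≢⇒All< bl (¬Any⇒All¬ l m∉l))

Distinct<-length≤ : ∀ n l → Distinct< n l → length l ≤ n
Distinct<-length≤ zero    []      _                    = z≤n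
Distinct<-length≤ zero    (_ ∷ _) (distinct< _ (() ∷ _))
Distinct<-length≤ (suc n) l d with n ∈? l
... | no n∉l = m≤n⇒m≤1+n (Distinct<-length≤ n l (Distinct<-∉max n∉l d))
... | yes n∈l with u , v , refl ← ∈-∃++ n∈l =
  subst (_≤ suc n) (sym (↭-length (shift n u v)))
    (s≤s (Distinct<-length≤ n (u ++ v) (Distinct<-max⁻ (Distinct<-resp-↭ (shift n u v) d))))

Distinct<-full⇒max∈ : ∀ n l → Distinct< (suc n) l → length l ≡ suc n → n ∈ l
Distinct<-full⇒max∈ n l d eq with n ∈? l
... | yes n∈l = n∈l
... | no n∉l = ⊥-elim (<-irrefl refl
  (≤-trans (≤-reflexive (sym eq)) (Distinct<-length≤ n l (Distinct<-∉max n∉l d))))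

increasing-∷ʳ⁺ : ∀ xs {m} → increasing xs ≡ true → All (_< m) xs → increasing (xs ∷ʳ m) ≡ true
increasing-∷ʳ⁺ []           _   _              = refl
increasing-∷ʳ⁺ (x ∷ [])     _   (x<m ∷ [])     = ∧-true⁺ (<ᵇ-true⁺ x<m) refl
increasing-∷ʳ⁺ (x ∷ y ∷ xs) inc (_ ∷ y∷xs<m) with ∧-true⁻ {x <ᵇ y} inc
... | x<y , inc′ = ∧-true⁺ x<y (increasing-∷ʳ⁺ (y ∷ xs) inc′ y∷xs<m)

increasing-++⁻ˡ : ∀ xs ys → increasing (xs ++ ys) ≡ true → increasing xs ≡ true
increasing-++⁻ˡ []           _  _   = refl
increasing-++⁻ˡ (x ∷ [])     _  _   = refl
increasing-++⁻ˡ (x ∷ y ∷ xs) ys inc =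
  ∧-true⁺ (proj₁ (∧-true⁻ {x <ᵇ y} inc)) (increasing-++⁻ˡ (y ∷ xs) ys (proj₂ (∧-true⁻ {x <ᵇ y} inc)))

increasing-max⇒last : ∀ xs {m} → increasing xs ≡ true → All (_< suc m) xs → m ∈ xs →
                      ∃ λ xs′ → xs ≡ xs′ ∷ʳ m
increasing-max⇒last (x ∷ [])     _   _               (here refl) = [] , refl
increasing-max⇒last (x ∷ y ∷ xs) inc (_ ∷ y≤m ∷ _) (here refl) =
  ⊥-elim (<⇒≱ (<ᵇ-true⁻ (proj₁ (∧-true⁻ {x <ᵇ y} inc))) (≤-pred y≤m))
increasing-max⇒last (x ∷ y ∷ xs) inc (_ ∷ bs) (there m∈) with ∧-true⁻ {x <ᵇ y} inc
... | _ , inc′ with xs′ , eq ← increasing-max⇒last (y ∷ xs) inc′ bs m∈ = x ∷ xs′ , cong (x ∷_) eq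

colsIncreasing-[] : ∀ xs → colsIncreasing xs [] ≡ true
colsIncreasing-[] []      = refl
colsIncreasing-[] (_ ∷ _) = refl

colsIncreasing-∷ʳ₂⁺ : ∀ xs ys {m} → colsIncreasing xs ys ≡ true → All (_< m) xs →
                      colsIncreasing xs (ys ∷ʳ m) ≡ true
colsIncreasing-∷ʳ₂⁺ []       _        _    _            = refl
colsIncreasing-∷ʳ₂⁺ (x ∷ xs) []       _    (x<m ∷ _)    = ∧-true⁺ (<ᵇ-true⁺ x<m) (colsIncreasing-[] xs)
colsIncreasing-∷ʳ₂⁺ (x ∷ xs) (y ∷ ys) cols (_ ∷ xs<m) with ∧-true⁻ {x <ᵇ y} cols
... | x<y , cols′ = ∧-true⁺ x<y (colsIncreasing-∷ʳ₂⁺ xs ys cols′ xs<m)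

colsIncreasing-∷ʳ₁⁺ : ∀ xs ys {m} → length ys ≤ length xs → colsIncreasing xs ys ≡ true →
                      colsIncreasing (xs ∷ʳ m) ys ≡ true
colsIncreasing-∷ʳ₁⁺ xs       []       _         _    = colsIncreasing-[] (xs ∷ʳ _)
colsIncreasing-∷ʳ₁⁺ (x ∷ xs) (y ∷ ys) (s≤s len) cols with ∧-true⁻ {x <ᵇ y} cols
... | x<y , cols′ = ∧-true⁺ x<y (colsIncreasing-∷ʳ₁⁺ xs ys len cols′)

colsIncreasing-++⁻₁ : ∀ xs us ys → colsIncreasing (xs ++ us) ys ≡ true → colsIncreasing xs ys ≡ true
colsIncreasing-++⁻₁ []       _  _        _    = refl
colsIncreasing-++⁻₁ (_ ∷ _)  _  []       _    = refl
colsIncreasing-++⁻₁ (x ∷ xs) us (y ∷ ys) cols with ∧-true⁻ {x <ᵇ y} cols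
... | x<y , cols′ = ∧-true⁺ x<y (colsIncreasing-++⁻₁ xs us ys cols′)

colsIncreasing-++⁻₂ : ∀ xs ys us → colsIncreasing xs (ys ++ us) ≡ true → colsIncreasing xs ys ≡ true
colsIncreasing-++⁻₂ []       _        _  _    = refl
colsIncreasing-++⁻₂ (_ ∷ _)  []       _  _    = refl
colsIncreasing-++⁻₂ (x ∷ xs) (y ∷ ys) us cols with ∧-true⁻ {x <ᵇ y} cols
... | x<y , cols′ = ∧-true⁺ x<y (colsIncreasing-++⁻₂ xs ys us cols′)

colsIncreasing-max-∷ʳ₁⇒length≤ : ∀ xs ys {m} → colsIncreasing (xs ∷ʳ m) ys ≡ true →
                                 All (_< suc m) ys → length ys ≤ length xs
colsIncreasing-max-∷ʳ₁⇒length≤ _        []       _    _ = z≤n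
colsIncreasing-max-∷ʳ₁⇒length≤ []       (y ∷ ys) cols (y≤m ∷ _) with ∧-true⁻ {_ <ᵇ y} cols
... | m<y , _ = ⊥-elim (<⇒≱ (<ᵇ-true⁻ m<y) (≤-pred y≤m))
colsIncreasing-max-∷ʳ₁⇒length≤ (x ∷ xs) (y ∷ ys) cols (_ ∷ ys≤m) with ∧-true⁻ {x <ᵇ y} cols
... | _ , cols′ = s≤s (colsIncreasing-max-∷ʳ₁⇒length≤ xs ys cols′ ys≤m)

length-∷ʳ : ∀ (xs : List ℕ) m → length (xs ∷ʳ m) ≡ suc (length xs)
length-∷ʳ []       m = refl
length-∷ʳ (x ∷ xs) m = cong suc (length-∷ʳ xs m)

Pair : Set
Pair = List ℕ × List ℕ

record Standard (n : ℕ) (xs ys : List ℕ) : Set where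
  constructor standard
  field
    entries            : Distinct< n (xs ++ ys)
    row₁-increasing    : increasing xs ≡ true
    row₂-increasing    : increasing ys ≡ true
    columns-increasing : colsIncreasing xs ys ≡ true

open Standard

record StandardOfShape (a b : ℕ) (p : Pair) : Set where
  constructor shaped
  field
    length₁       : length (proj₁ p) ≡ a
    length₂       : length (proj₂ p) ≡ b
    rows-standard : Standard (a + b) (proj₁ p) (proj₂ p)

open StandardOfShape

row₁-bounded : ∀ {a b xs ys} → StandardOfShape a b (xs , ys) → All (_< a + b) xs
row₁-bounded {xs = xs} s = ++⁻ˡ xs (bounded (entries (rows-standard s)))

row₂-bounded : ∀ {a b xs ys} → StandardOfShape a b (xs , ys) → All (_< a + b) ys
row₂-bounded {xs = xs} s = ++⁻ʳ xs (bounded (entries (rows-standard s)))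

∷ʳ₁-↭ : ∀ (xs ys : List ℕ) m → (xs ∷ʳ m) ++ ys ↭ m ∷ xs ++ ys
∷ʳ₁-↭ xs ys m = ↭-trans (↭-reflexive (++-assoc xs [ m ] ys)) (shift m xs ys)

∷ʳ₂-↭ : ∀ (xs ys : List ℕ) m → xs ++ (ys ∷ʳ m) ↭ m ∷ xs ++ ys
∷ʳ₂-↭ xs ys m = ↭-trans (↭-reflexive (sym (++-assoc xs ys [ m ]))) (↭-sym (∷↭∷ʳ m (xs ++ ys)))

Standard-∷ʳ₁⁺ : ∀ {m xs ys} → length ys ≤ length xs → Standard m xs ys → Standard (suc m) (xs ∷ʳ m) ys
Standard-∷ʳ₁⁺ {m} {xs} {ys} len (standard e inc₁ inc₂ cols) = standard
  (Distinct<-resp-↭ (↭-sym (∷ʳ₁-↭ xs ys m)) (Distinct<-max⁺ e))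
  (increasing-∷ʳ⁺ xs inc₁ (++⁻ˡ xs (bounded e)))
  inc₂
  (colsIncreasing-∷ʳ₁⁺ xs ys len cols)

Standard-∷ʳ₂⁺ : ∀ {m xs ys} → Standard m xs ys → Standard (suc m) xs (ys ∷ʳ m)
Standard-∷ʳ₂⁺ {m} {xs} {ys} (standard e inc₁ inc₂ cols) = standard
  (Distinct<-resp-↭ (↭-sym (∷ʳ₂-↭ xs ys m)) (Distinct<-max⁺ e))
  inc₁
  (increasing-∷ʳ⁺ ys inc₂ (++⁻ʳ xs (bounded e)))
  (colsIncreasing-∷ʳ₂⁺ xs ys cols (++⁻ˡ xs (bounded e)))

Standard-∷ʳ₁⁻ : ∀ {m xs ys} → Standard (suc m) (xs ∷ʳ m) ys → Standard m xs ys
Standard-∷ʳ₁⁻ {m} {xs} {ys} (standard e inc₁ inc₂ cols) = standard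
  (Distinct<-max⁻ (Distinct<-resp-↭ (∷ʳ₁-↭ xs ys m) e))
  (increasing-++⁻ˡ xs [ m ] inc₁)
  inc₂
  (colsIncreasing-++⁻₁ xs [ m ] ys cols)

Standard-∷ʳ₂⁻ : ∀ {m xs ys} → Standard (suc m) xs (ys ∷ʳ m) → Standard m xs ys
Standard-∷ʳ₂⁻ {m} {xs} {ys} (standard e inc₁ inc₂ cols) = standard
  (Distinct<-max⁻ (Distinct<-resp-↭ (∷ʳ₂-↭ xs ys m) e))
  inc₁
  (increasing-++⁻ˡ ys [ m ] inc₂)
  (colsIncreasing-++⁻₂ xs ys [ m ] cols)

-- Enumerating standard pairs by the position of the largest entry

append₁ append₂ : ℕ → Pair → Pair
append₁ m (xs , ys) = xs ∷ʳ m , ys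
append₂ m (xs , ys) = xs , ys ∷ʳ m

guard : {A : Set} → Bool → List A → List A
guard true  l = l
guard false _ = []

-- The largest entry can end the first row of shape (1 + a, 1 + b) only when removing it
-- leaves a partition (a, 1 + b), i.e. b < a.
standardPairs : ℕ → ℕ → List Pair
standardPairs zero    zero    = [ ([] , []) ]
standardPairs zero    (suc b) = map (append₂ b) (standardPairs zero b)
standardPairs (suc a) zero    = map (append₁ a) (standardPairs a zero)
standardPairs (suc a) (suc b) =
  map (append₂ (a + suc b)) (standardPairs (suc a) b)
  ++ guard (b <ᵇ a) (map (append₁ (a + suc b)) (standardPairs a (suc b)))

∈-guard⁻ : ∀ {A : Set} c {x : A} {l} → x ∈ guard c l → c ≡ true × x ∈ l
∈-guard⁻ true x∈l = refl , x∈l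

append₁-shape⁺ : ∀ {a b m p} → m ≡ a + b → b ≤ a → StandardOfShape a b p → StandardOfShape (suc a) b (append₁ m p)
append₁-shape⁺ {p = xs , ys} refl b≤a (shaped refl refl st) =
  shaped (length-∷ʳ xs _) refl (Standard-∷ʳ₁⁺ b≤a st)

append₂-shape⁺ : ∀ {a b m p} → m ≡ a + b → StandardOfShape a b p → StandardOfShape a (suc b) (append₂ m p)
append₂-shape⁺ {a} {b} {p = xs , ys} refl (shaped refl refl st) =
  shaped refl (length-∷ʳ ys _) (subst (λ n → Standard n xs (ys ∷ʳ (a + b))) (sym (+-suc a b)) (Standard-∷ʳ₂⁺ st))

append₁-shape⁻ : ∀ {a b m xs ys} → m ≡ a + b → StandardOfShape (suc a) b (xs ∷ʳ m , ys) → StandardOfShape a b (xs , ys)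
append₁-shape⁻ {xs = xs} refl (shaped len refl st) =
  shaped (suc-injective (trans (sym (length-∷ʳ xs _)) len)) refl (Standard-∷ʳ₁⁻ st)

append₂-shape⁻ : ∀ {a b m xs ys} → m ≡ a + b → StandardOfShape a (suc b) (xs , ys ∷ʳ m) → StandardOfShape a b (xs , ys)
append₂-shape⁻ {a} {b} {xs = xs} {ys} refl (shaped refl len st) =
  shaped refl (suc-injective (trans (sym (length-∷ʳ ys _)) len))
    (Standard-∷ʳ₂⁻ (subst (λ n → Standard n xs (ys ∷ʳ (a + b))) (+-suc a b) st))

∈-map-append₁-shape : ∀ {a b m L p} → m ≡ a + b → b ≤ a → (∀ {p′} → p′ ∈ L → StandardOfShape a b p′) →
                      p ∈ map (append₁ m) L → StandardOfShape (suc a) b p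
∈-map-append₁-shape {m = m} eq b≤a sound p∈ with _ , p′∈ , refl ← ∈-map⁻ (append₁ m) p∈ =
  append₁-shape⁺ eq b≤a (sound p′∈)

∈-map-append₂-shape : ∀ {a b m L p} → m ≡ a + b → (∀ {p′} → p′ ∈ L → StandardOfShape a b p′) →
                      p ∈ map (append₂ m) L → StandardOfShape a (suc b) p
∈-map-append₂-shape {m = m} eq sound p∈ with _ , p′∈ , refl ← ∈-map⁻ (append₂ m) p∈ =
  append₂-shape⁺ eq (sound p′∈)

standardPairs-sound : ∀ a b {p} → p ∈ standardPairs a b → StandardOfShape a b p
standardPairs-sound zero    zero    (here refl) = shaped refl refl (standard (distinct< [] []) refl refl refl)
standardPairs-sound zero    (suc b) = ∈-map-append₂-shape refl (standardPairs-sound zero b)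
standardPairs-sound (suc a) zero    = ∈-map-append₁-shape (sym (+-identityʳ a)) z≤n (standardPairs-sound a zero)
standardPairs-sound (suc a) (suc b) p∈ with ∈-++⁻ (map (append₂ (a + suc b)) (standardPairs (suc a) b)) p∈
... | inj₁ p∈₂ = ∈-map-append₂-shape (+-suc a b) (standardPairs-sound (suc a) b) p∈₂
... | inj₂ p∈₁ with b<a , p∈₁′ ← ∈-guard⁻ (b <ᵇ a) p∈₁ =
  ∈-map-append₁-shape refl (<ᵇ-true⁻ b<a) (standardPairs-sound a (suc b)) p∈₁′

append₁-shape⇒≤ : ∀ {a b m xs ys} → m ≡ a + b → StandardOfShape (suc a) b (xs ∷ʳ m , ys) → b ≤ a
append₁-shape⇒≤ {xs = xs} {ys} refl (shaped len refl (standard e _ _ cols)) =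
  subst (length ys ≤_) (suc-injective (trans (sym (length-∷ʳ xs _)) len))
    (colsIncreasing-max-∷ʳ₁⇒length≤ xs ys cols (++⁻ʳ (xs ∷ʳ _) (bounded e)))

largest-ends-a-row : ∀ {a b m xs ys} → a + b ≡ suc m → StandardOfShape a b (xs , ys) →
                     (∃ λ xs′ → xs ≡ xs′ ∷ʳ m) ⊎ (∃ λ ys′ → ys ≡ ys′ ∷ʳ m)
largest-ends-a-row {m = m} {xs} {ys} eq (shaped len₁ len₂ (standard e inc₁ inc₂ _)) =
  Sum.map (increasing-max⇒last xs inc₁ (++⁻ˡ xs (bounded e′))) (increasing-max⇒last ys inc₂ (++⁻ʳ xs (bounded e′)))
    (∈-++⁻ xs (Distinct<-full⇒max∈ m (xs ++ ys) e′ (trans (length-++ xs) (trans (cong₂ _+_ len₁ len₂) eq))))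
  where
  e′ : Distinct< (suc m) (xs ++ ys)
  e′ = subst (λ n → Distinct< n (xs ++ ys)) eq e

∈-map-append₁ : ∀ {a b m L xs ys} → (∀ {p} → StandardOfShape a b p → p ∈ L) → m ≡ a + b →
                StandardOfShape (suc a) b (xs ∷ʳ m , ys) → (xs ∷ʳ m , ys) ∈ map (append₁ m) L
∈-map-append₁ {m = m} complete eq s = ∈-map⁺ (append₁ m) (complete (append₁-shape⁻ eq s))

∈-map-append₂ : ∀ {a b m L xs ys} → (∀ {p} → StandardOfShape a b p → p ∈ L) → m ≡ a + b →
                StandardOfShape a (suc b) (xs , ys ∷ʳ m) → (xs , ys ∷ʳ m) ∈ map (append₂ m) L
∈-map-append₂ {m = m} complete eq s = ∈-map⁺ (append₂ m) (complete (append₂-shape⁻ eq s))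

Complete : ℕ → ℕ → Set
Complete a b = ∀ {p} → StandardOfShape a b p → p ∈ standardPairs a b

complete-zero-suc : ∀ b → Complete zero b → Complete zero (suc b)
complete-zero-suc b complete {xs , ys} s with largest-ends-a-row refl s
... | inj₁ (xs′ , refl) with () ← trans (sym (length-∷ʳ xs′ b)) (length₁ s)
... | inj₂ (ys′ , refl) = ∈-map-append₂ complete refl s

complete-suc-zero : ∀ a → Complete a zero → Complete (suc a) zero
complete-suc-zero a complete {xs , ys} s with largest-ends-a-row (cong suc (+-identityʳ a)) s
... | inj₁ (xs′ , refl) = ∈-map-append₁ complete (sym (+-identityʳ a)) s
... | inj₂ (ys′ , refl) with () ← trans (sym (length-∷ʳ ys′ a)) (length₂ s)

complete-suc-suc : ∀ a b → Complete (suc a) b → Complete a (suc b) → Complete (suc a) (suc b)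
complete-suc-suc a b complete₂ complete₁ {xs , ys} s with largest-ends-a-row refl s
... | inj₂ (ys′ , refl) = ∈-++⁺ˡ (∈-map-append₂ complete₂ (+-suc a b) s)
... | inj₁ (xs′ , refl) with b <ᵇ a in b<a
...   | true  = ∈-++⁺ʳ _ (∈-map-append₁ complete₁ refl s)
...   | false with () ← trans (sym (<ᵇ-true⁺ (append₁-shape⇒≤ refl s))) b<a

standardPairs-complete : ∀ a b → Complete a b
standardPairs-complete zero    zero    {[] , []}    _               = here refl
standardPairs-complete zero    zero    {_ ∷ _ , _}  (shaped () _ _)
standardPairs-complete zero    zero    {[] , _ ∷ _} (shaped _ () _)
standardPairs-complete zero    (suc b) = complete-zero-suc b (standardPairs-complete zero b)
standardPairs-complete (suc a) zero    = complete-suc-zero a (standardPairs-complete a zero)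
standardPairs-complete (suc a) (suc b) =
  complete-suc-suc a b (standardPairs-complete (suc a) b) (standardPairs-complete a (suc b))

append₁-injective : ∀ {m p p′} → append₁ m p ≡ append₁ m p′ → p ≡ p′
append₁-injective {p = xs , _} {xs′ , _} eq = cong₂ _,_ (∷ʳ-injectiveˡ xs xs′ (cong proj₁ eq)) (cong proj₂ eq)

append₂-injective : ∀ {m p p′} → append₂ m p ≡ append₂ m p′ → p ≡ p′
append₂-injective {p = _ , ys} {_ , ys′} eq = cong₂ _,_ (cong proj₁ eq) (∷ʳ-injectiveˡ ys ys′ (cong proj₂ eq))

append₂≢append₁ : ∀ {m xs ys p′} → All (_< m) xs → append₂ m (xs , ys) ≢ append₁ m p′
append₂≢append₁ {p′ = xs′ , _} xs<m eq = <-irrefl refl (lookup xs<m (subst (_ ∈_) (sym (cong proj₁ eq)) (∈-++⁺ʳ xs′ (here refl))))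

Unique-guard : ∀ {A : Set} c {l : List A} → Unique l → Unique (guard c l)
Unique-guard true  ul = ul
Unique-guard false _  = []

standardPairs-unique : ∀ a b → Unique (standardPairs a b)
standardPairs-unique zero    zero    = [] ∷ []
standardPairs-unique zero    (suc b) = Unique.map⁺ append₂-injective (standardPairs-unique zero b)
standardPairs-unique (suc a) zero    = Unique.map⁺ append₁-injective (standardPairs-unique a zero)
standardPairs-unique (suc a) (suc b) =
  Unique.++⁺ (Unique.map⁺ append₂-injective (standardPairs-unique (suc a) b))
             (Unique-guard (b <ᵇ a) (Unique.map⁺ append₁-injective (standardPairs-unique a (suc b))))
             disjoint
  where
  m = a + suc b
  disjoint : ∀ {v} → ¬ (v ∈ map (append₂ m) (standardPairs (suc a) b)
                       × v ∈ guard (b <ᵇ a) (map (append₁ m) (standardPairs a (suc b))))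
  disjoint (v∈₂ , v∈₁) with (xs , ys) , p∈ , refl ← ∈-map⁻ (append₂ m) v∈₂
                        | _ , _ , eq ← ∈-map⁻ (append₁ m) (proj₂ (∈-guard⁻ (b <ᵇ a) v∈₁)) =
    append₂≢append₁ (subst (λ n → All (_< n) xs) (sym (+-suc a b)) (row₁-bounded (standardPairs-sound (suc a) b p∈))) eq

-- Standard tableaux are the standard pairs

toℕs : ∀ {n m} → Vec (Fin n) m → List ℕ
toℕs v = map toℕ (toList v)

length-toℕs : ∀ {n m} (v : Vec (Fin n) m) → length (toℕs v) ≡ m
length-toℕs []      = refl
length-toℕs (_ ∷ v) = cong suc (length-toℕs v)

toℕs-bounded : ∀ {n m} (v : Vec (Fin n) m) → All (_< n) (toℕs v)
toℕs-bounded []      = []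
toℕs-bounded (x ∷ v) = toℕ<n x ∷ toℕs-bounded v

toℕs-injective : ∀ {n m} (v w : Vec (Fin n) m) → toℕs v ≡ toℕs w → v ≡ w
toℕs-injective []      []      _  = refl
toℕs-injective (x ∷ v) (y ∷ w) eq =
  cong₂ _∷_ (toℕ-injective (proj₁ (∷-injective eq))) (toℕs-injective v w (proj₂ (∷-injective eq)))

toℕs-surjective : ∀ n (xs : List ℕ) → All (_< n) xs → Σ (Vec (Fin n) (length xs)) (λ v → toℕs v ≡ xs)
toℕs-surjective n []       []          = [] , refl
toℕs-surjective n (x ∷ xs) (x<n ∷ xs<n) with v , eq ← toℕs-surjective n xs xs<n =
  fromℕ< x<n ∷ v , cong₂ _∷_ (toℕ-fromℕ< x<n) eq

rows : ∀ {a b} → Filling a b → Pair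
rows T = row1 T , row2 T

rows-injective : ∀ {a b} {T T′ : Filling a b} → rows T ≡ rows T′ → T ≡ T′
rows-injective {T = v₁ , v₂} {w₁ , w₂} eq =
  cong₂ _,_ (toℕs-injective v₁ w₁ (cong proj₁ eq)) (toℕs-injective v₂ w₂ (cong proj₂ eq))

allVecs-complete : ∀ n m (v : Vec (Fin n) m) → v ∈ allVecs n m
allVecs-complete n zero    []      = here refl
allVecs-complete n (suc m) (x ∷ v) = go (allFin n) (∈-allFin x)
  where
  go : ∀ ys → x ∈ ys → (x ∷ v) ∈ concatMap (λ y → map (y ∷_) (allVecs n m)) ys
  go (y ∷ ys) (here refl) = ∈-++⁺ˡ (∈-map⁺ (x ∷_) (allVecs-complete n m v))
  go (y ∷ ys) (there x∈) = ∈-++⁺ʳ (map (y ∷_) (allVecs n m)) (go ys x∈)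

allVecs-unique : ∀ n m → Unique (allVecs n m)
allVecs-unique n zero    = [] ∷ []
allVecs-unique n (suc m) = go (allFin n) (Unique.allFin⁺ n)
  where
  withHead : Fin n → List (Vec (Fin n) (suc m))
  withHead y = map (y ∷_) (allVecs n m)

  head∈ : ∀ ys {v} → v ∈ concatMap withHead ys → head v ∈ ys
  head∈ (y ∷ ys) v∈ with ∈-++⁻ (withHead y) v∈
  ... | inj₁ v∈y with _ , _ , refl ← ∈-map⁻ (y ∷_) v∈y = here refl
  ... | inj₂ v∈ys = there (head∈ ys v∈ys)

  ∷-injectiveʳ : ∀ {y} {v w : Vec (Fin n) m} → _≡_ {A = Vec (Fin n) (suc m)} (y ∷ v) (y ∷ w) → v ≡ w
  ∷-injectiveʳ refl = refl

  go : ∀ ys → Unique ys → Unique (concatMap withHead ys)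
  go []       _          = []
  go (y ∷ ys) (y∉ys ∷ uys) = Unique.++⁺ (Unique.map⁺ ∷-injectiveʳ (allVecs-unique n m)) (go ys uys) disjoint
    where
    disjoint : ∀ {v} → ¬ (v ∈ withHead y × v ∈ concatMap withHead ys)
    disjoint (v∈y , v∈ys) with _ , _ , refl ← ∈-map⁻ (y ∷_) v∈y = lookup y∉ys (head∈ ys v∈ys) refl

standardᵇ : List ℕ → List ℕ → Bool
standardᵇ xs ys = distinct (xs ++ ys) ∧ increasing xs ∧ increasing ys ∧ colsIncreasing xs ys

standardᵇ⇒Standard : ∀ {n} xs ys → All (_< n) (xs ++ ys) → standardᵇ xs ys ≡ true → Standard n xs ys
standardᵇ⇒Standard xs ys bs std with d , std′ ← ∧-true⁻ {distinct (xs ++ ys)} std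
                                 with inc₁ , std″ ← ∧-true⁻ {increasing xs} std′
                                 with inc₂ , cols ← ∧-true⁻ {increasing ys} std″ =
  standard (distinct< (distinct⇒Unique _ d) bs) inc₁ inc₂ cols

Standard⇒standardᵇ : ∀ {n xs ys} → Standard n xs ys → standardᵇ xs ys ≡ true
Standard⇒standardᵇ (standard e inc₁ inc₂ cols) =
  ∧-true⁺ (Unique⇒distinct _ (unique e)) (∧-true⁺ inc₁ (∧-true⁺ inc₂ cols))

rows-standardTableau : ∀ a b {p} → p ∈ map rows (standardTableaux a b) → StandardOfShape a b p
rows-standardTableau a b p∈ with (v₁ , v₂) , T∈ , refl ← ∈-map⁻ rows p∈ =
  shaped (length-toℕs v₁) (length-toℕs v₂)
    (standardᵇ⇒Standard (toℕs v₁) (toℕs v₂) (++⁺ (toℕs-bounded v₁) (toℕs-bounded v₂))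
      (proj₂ (∈-filter⁻ (λ T → isStandard T ≟ᵇ true) {xs = allFillings a b} T∈)))

standardTableau-rows : ∀ a b {p} → StandardOfShape a b p → p ∈ map rows (standardTableaux a b)
standardTableau-rows _ _ {xs , ys} (shaped refl refl st)
  with v₁ , eq₁ ← toℕs-surjective _ xs (++⁻ˡ xs (bounded (entries st)))
     | v₂ , eq₂ ← toℕs-surjective _ ys (++⁻ʳ xs (bounded (entries st))) =
  subst (_∈ map rows (standardTableaux _ _)) (cong₂ _,_ eq₁ eq₂)
    (∈-map⁺ rows (∈-filter⁺ (λ T → isStandard T ≟ᵇ true)
      (∈-cartesianProduct⁺ (allVecs-complete _ _ v₁) (allVecs-complete _ _ v₂))
      (trans (cong₂ standardᵇ eq₁ eq₂) (Standard⇒standardᵇ st))))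

rows-standardTableaux↭standardPairs : ∀ a b → map rows (standardTableaux a b) ↭ standardPairs a b
rows-standardTableaux↭standardPairs a b = ∼bag⇒↭ (unique∧set⇒bag
  (Unique.map⁺ rows-injective (Unique.filter⁺ (λ T → isStandard T ≟ᵇ true)
    (Unique.cartesianProduct⁺ (allVecs-unique _ a) (allVecs-unique _ b))))
  (standardPairs-unique a b)
  (mk⇔ (standardPairs-complete a b ∘ rows-standardTableau a b) (standardTableau-rows a b ∘ standardPairs-sound a b)))

-- Every c_ij is 1 or 2, so c_q(T) is a power of 1 + q

Σ<-cong : ∀ n {g h : ℕ → ℕ} → (∀ i → i < n → g i ≡ h i) → Σ< n g ≡ Σ< n h
Σ<-cong zero    _   = refl
Σ<-cong (suc n) g≡h = cong₂ _+_ (Σ<-cong n (λ i i<n → g≡h i (m<n⇒m<1+n i<n))) (g≡h n ≤-refl)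

Σ<-vanishing : ∀ j d (g : ℕ → ℕ) → (∀ i → j ≤ i → g i ≡ 0) → Σ< (d + j) g ≡ Σ< j g
Σ<-vanishing j zero    g _  = refl
Σ<-vanishing j (suc d) g g≡0 =
  trans (cong₂ _+_ (Σ<-vanishing j d g g≡0) (g≡0 (d + j) (m≤n+m j d))) (+-identityʳ _)

qint*ₚ : ∀ c r k → c ≤ suc k → (qint c *ₚ r) k ≡ Σ< c (λ i → r (k ∸ i))
qint*ₚ c r k c≤1+k = begin
  Σ< (suc k) g               ≡⟨ cong (λ n → Σ< n g) (sym (m∸n+n≡m c≤1+k)) ⟩
  Σ< (suc k ∸ c + c) g       ≡⟨ Σ<-vanishing c (suc k ∸ c) g (λ i c≤i → cong (_* r (k ∸ i)) (qint-out c≤i)) ⟩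
  Σ< c g                     ≡⟨ Σ<-cong c (λ i i<c → trans (cong (_* r (k ∸ i)) (qint-in i<c)) (*-identityˡ _)) ⟩
  Σ< c (λ i → r (k ∸ i))     ∎
  where
  open ≡-Reasoning
  g : ℕ → ℕ
  g i = qint c i * r (k ∸ i)
  qint-in : ∀ {i} → i < c → qint c i ≡ 1
  qint-in i<c rewrite <ᵇ-true⁺ i<c = refl
  qint-out : ∀ {i} → c ≤ i → qint c i ≡ 0
  qint-out c≤i rewrite <ᵇ-false⁺ c≤i = refl

OneOrTwo : ℕ → Set
OneOrTwo c = c ≡ 1 ⊎ c ≡ 2

twos : List ℕ → ℕ
twos cs = sum (map pred cs)

nC0≡1 : ∀ n → n C 0 ≡ 1
nC0≡1 n = trans (nCk≡nC[n∸k] {0} {n} z≤n) (nCn≡1 n)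

prodₚ-qint : ∀ cs k → All OneOrTwo cs → prodₚ (map qint cs) k ≡ twos cs C k
prodₚ-qint []      zero    []                = refl
prodₚ-qint []      (suc k) []                = refl
prodₚ-qint (1 ∷ cs) k      (inj₁ refl ∷ ocs) =
  trans (qint*ₚ 1 (prodₚ (map qint cs)) k (s≤s z≤n)) (prodₚ-qint cs k ocs)
prodₚ-qint (2 ∷ cs) zero   (inj₂ refl ∷ ocs) =
  trans (+-identityʳ _) (trans (prodₚ-qint cs zero ocs) (trans (nC0≡1 (twos cs)) (sym (nC0≡1 (suc (twos cs))))))
prodₚ-qint (2 ∷ cs) (suc k) (inj₂ refl ∷ ocs) = begin
  (qint 2 *ₚ prodₚ (map qint cs)) (suc k)              ≡⟨ qint*ₚ 2 (prodₚ (map qint cs)) (suc k) (s≤s (s≤s z≤n)) ⟩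
  prodₚ (map qint cs) (suc k) + prodₚ (map qint cs) k  ≡⟨ cong₂ _+_ (prodₚ-qint cs (suc k) ocs) (prodₚ-qint cs k ocs) ⟩
  twos cs C suc k + twos cs C k                        ≡⟨ +-comm (twos cs C suc k) (twos cs C k) ⟩
  twos cs C k + twos cs C suc k                        ≡⟨ nCk+nC[k+1]≡[n+1]C[k+1] (twos cs) k ⟩
  suc (twos cs) C suc k                                ∎
  where open ≡-Reasoning

b2n-true : ∀ {c} → c ≡ true → b2n c ≡ 1
b2n-true refl = refl

cRow1-OneOrTwo : ∀ xs ys → increasing xs ≡ true → All OneOrTwo (cRow1 xs ys)
cRow1-OneOrTwo []           _        _   = []
cRow1-OneOrTwo (_ ∷ [])     _        _   = []
cRow1-OneOrTwo (x ∷ y ∷ xs) []       inc =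
  inj₁ (b2n-true (proj₁ (∧-true⁻ {x <ᵇ y} inc))) ∷ cRow1-OneOrTwo (y ∷ xs) [] (proj₂ (∧-true⁻ {x <ᵇ y} inc))
cRow1-OneOrTwo (x ∷ y ∷ xs) (z ∷ zs) inc =
  oneOrTwo (proj₁ (∧-true⁻ {x <ᵇ y} inc)) (z <ᵇ y) ∷ cRow1-OneOrTwo (y ∷ xs) zs (proj₂ (∧-true⁻ {x <ᵇ y} inc))
  where
  oneOrTwo : ∀ {c} → c ≡ true → ∀ d → OneOrTwo (b2n c + b2n d)
  oneOrTwo refl true  = inj₂ refl
  oneOrTwo refl false = inj₁ refl

cRow2-ones : ∀ ys → increasing ys ≡ true → All (_≡ 1) (cRow2 ys)
cRow2-ones []           _   = []
cRow2-ones (_ ∷ [])     _   = []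
cRow2-ones (y ∷ z ∷ ys) inc =
  b2n-true (proj₁ (∧-true⁻ {y <ᵇ z} inc)) ∷ cRow2-ones (z ∷ ys) (proj₂ (∧-true⁻ {y <ᵇ z} inc))

twos-ones : ∀ cs → All (_≡ 1) cs → twos cs ≡ 0
twos-ones []       []            = refl
twos-ones (.1 ∷ cs) (refl ∷ ones) = twos-ones cs ones

twos-++ : ∀ cs ds → twos (cs ++ ds) ≡ twos cs + twos ds
twos-++ cs ds = trans (cong sum (map-++ pred cs ds)) (sum-++ (map pred cs) (map pred ds))

-- the number of first-row cells with c = 2 (second-row cells always have c = 1)
doubledCells : Pair → ℕ
doubledCells (xs , ys) = twos (cRow1 xs ys)

weightCoeff : ℕ → Pair → ℕ
weightCoeff k (xs , ys) = prodₚ (map qint (cRow1 xs ys ++ cRow2 ys)) k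

weightCoeff-standard : ∀ {n xs ys} k → Standard n xs ys → weightCoeff k (xs , ys) ≡ doubledCells (xs , ys) C k
weightCoeff-standard {xs = xs} {ys} k (standard _ inc₁ inc₂ _) = begin
  weightCoeff k (xs , ys)                       ≡⟨ prodₚ-qint (cRow1 xs ys ++ cRow2 ys) k
                                                     (++⁺ (cRow1-OneOrTwo xs ys inc₁) (All.map inj₁ (cRow2-ones ys inc₂))) ⟩
  twos (cRow1 xs ys ++ cRow2 ys) C k            ≡⟨ cong (_C k) (twos-++ (cRow1 xs ys) (cRow2 ys)) ⟩
  (twos (cRow1 xs ys) + twos (cRow2 ys)) C k    ≡⟨ cong (λ t → (twos (cRow1 xs ys) + t) C k) (twos-ones _ (cRow2-ones ys inc₂)) ⟩
  (twos (cRow1 xs ys) + 0) C k                  ≡⟨ cong (_C k) (+-identityʳ _) ⟩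
  doubledCells (xs , ys) C k                    ∎
  where open ≡-Reasoning

cRow1-∷ʳ₂ : ∀ m xs ys → All (_< m) xs → cRow1 xs (ys ∷ʳ m) ≡ cRow1 xs ys
cRow1-∷ʳ₂ m []           _        _               = refl
cRow1-∷ʳ₂ m (_ ∷ [])     _        _               = refl
cRow1-∷ʳ₂ m (x ∷ y ∷ xs) []       (_ ∷ y<m ∷ _)   rewrite <ᵇ-false⁺ (<⇒≤ y<m) = cong (_∷ _) (+-identityʳ _)
cRow1-∷ʳ₂ m (x ∷ y ∷ xs) (z ∷ zs) (_ ∷ y∷xs<m)   = cong (_ ∷_) (cRow1-∷ʳ₂ m (y ∷ xs) zs y∷xs<m)

doubledCells-append₂ : ∀ m xs ys → All (_< m) xs → doubledCells (append₂ m (xs , ys)) ≡ doubledCells (xs , ys)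
doubledCells-append₂ m xs ys xs<m = cong twos (cRow1-∷ʳ₂ m xs ys xs<m)

-- 1 exactly when a cell appended to a first row of length a has a cell of the second row,
-- of length b, to its lower left, i.e. when b = a ≥ 1
lowerLeftCell : ℕ → ℕ → ℕ
lowerLeftCell zero    _ = 0
lowerLeftCell (suc b) a = b2n (suc b ≡ᵇ a)

doubledCells-append₁ : ∀ m xs ys → All (_< m) xs → All (_< m) ys → length ys ≤ length xs →
                       doubledCells (append₁ m (xs , ys)) ≡ doubledCells (xs , ys) + lowerLeftCell (length ys) (length xs)
doubledCells-append₁ m []           []            _             _             _       = refl
doubledCells-append₁ m (x ∷ [])     []            (x<m ∷ [])    _             _       rewrite <ᵇ-true⁺ x<m = refl
doubledCells-append₁ m (x ∷ [])     (z ∷ [])      (x<m ∷ [])    (z<m ∷ [])    _       rewrite <ᵇ-true⁺ x<m | <ᵇ-true⁺ z<m = refl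
doubledCells-append₁ m (x ∷ [])     (_ ∷ _ ∷ _)   _             _             (s≤s ())
doubledCells-append₁ m (x ∷ y ∷ xs) []            (_ ∷ y∷xs<m)  ys<m          _       =
  trans (cong (pred (b2n (x <ᵇ y)) +_) (doubledCells-append₁ m (y ∷ xs) [] y∷xs<m ys<m z≤n))
        (sym (+-assoc (pred (b2n (x <ᵇ y))) _ 0))
doubledCells-append₁ m (x ∷ y ∷ xs) (z ∷ zs)      (_ ∷ y∷xs<m)  (_ ∷ zs<m)    (s≤s len) =
  trans (cong (c +_) (trans (doubledCells-append₁ m (y ∷ xs) zs y∷xs<m zs<m len)
                            (cong (doubledCells (y ∷ xs , zs) +_) (shift-lowerLeft zs))))
        (sym (+-assoc c (doubledCells (y ∷ xs , zs)) _))
  where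
  c = pred (b2n (x <ᵇ y) + b2n (z <ᵇ y))
  shift-lowerLeft : ∀ zs → lowerLeftCell (length zs) (length (y ∷ xs))
                          ≡ lowerLeftCell (length (z ∷ zs)) (length (x ∷ y ∷ xs))
  shift-lowerLeft []      = refl
  shift-lowerLeft (_ ∷ _) = refl

sumₚ-map : ∀ {A : Set} (g : A → Poly) L k → sumₚ (map g L) k ≡ sum (map (λ x → g x k) L)
sumₚ-map g []      k = refl
sumₚ-map g (x ∷ L) k = cong (g x k +_) (sumₚ-map g L k)

sum-map-cong-∈ : ∀ {A : Set} {g h : A → ℕ} L → (∀ {x} → x ∈ L → g x ≡ h x) → sum (map g L) ≡ sum (map h L)
sum-map-cong-∈ L g≡h = cong sum (map-cong-local (All.tabulate g≡h))

sum-map-+ : ∀ {A : Set} (g h : A → ℕ) L → sum (map (λ x → g x + h x) L) ≡ sum (map g L) + sum (map h L)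
sum-map-+ g h []      = refl
sum-map-+ g h (x ∷ L) = trans (cong (g x + h x +_) (sum-map-+ g h L)) (interchange (g x) (h x) _ _)

weightSum : List Pair → ℕ → ℕ
weightSum L k = sum (map (λ p → doubledCells p C k) L)

coeff : ℕ → ℕ → ℕ → ℕ
coeff a b = weightSum (standardPairs a b)

count : ℕ → ℕ → ℕ
count a b = length (standardPairs a b)

bpoly≡coeff : ∀ a b k → bpoly a b k ≡ coeff a b k
bpoly≡coeff a b k = begin
  bpoly a b k
    ≡⟨ sumₚ-map cq (standardTableaux a b) k ⟩
  sum (map (λ T → cq T k) (standardTableaux a b))
    ≡⟨ cong sum (map-∘ (standardTableaux a b)) ⟩
  sum (map (weightCoeff k) (map rows (standardTableaux a b)))
    ≡⟨ sum-↭ (↭-map⁺ (weightCoeff k) (rows-standardTableaux↭standardPairs a b)) ⟩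
  sum (map (weightCoeff k) (standardPairs a b))
    ≡⟨ sum-map-cong-∈ (standardPairs a b) (weightCoeff-standard k ∘ rows-standard ∘ standardPairs-sound a b) ⟩
  coeff a b k
    ∎
  where open ≡-Reasoning

f≡count : ∀ a b → f a b ≡ count a b
f≡count a b = trans (sym (length-map rows (standardTableaux a b))) (↭-length (rows-standardTableaux↭standardPairs a b))

count-zero : ∀ a → count a 0 ≡ 1
count-zero zero    = refl
count-zero (suc a) = trans (length-map (append₁ a) (standardPairs a 0)) (count-zero a)

count-pascal : ∀ a b → b < a → count (suc a) (suc b) ≡ count (suc a) b + count a (suc b)
count-pascal a b b<a rewrite <ᵇ-true⁺ b<a =
  trans (length-++ (map (append₂ (a + suc b)) (standardPairs (suc a) b)))
        (cong₂ _+_ (length-map _ (standardPairs (suc a) b)) (length-map _ (standardPairs a (suc b))))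

count-skew : ∀ a b → a ≤ b → count (suc a) (suc b) ≡ count (suc a) b
count-skew a b a≤b rewrite <ᵇ-false⁺ a≤b =
  trans (cong length (++-identityʳ (map (append₂ (a + suc b)) (standardPairs (suc a) b))))
        (length-map _ (standardPairs (suc a) b))

weightSum-append₂ : ∀ a b m k → m ≡ a + b → weightSum (map (append₂ m) (standardPairs a b)) k ≡ coeff a b k
weightSum-append₂ a b m k refl =
  trans (cong sum (sym (map-∘ (standardPairs a b))))
        (sum-map-cong-∈ (standardPairs a b) (λ p∈ → cong (_C k) (unchanged p∈)))
  where
  unchanged : ∀ {p} → p ∈ standardPairs a b → doubledCells (append₂ (a + b) p) ≡ doubledCells p
  unchanged {xs , ys} p∈ = doubledCells-append₂ (a + b) xs ys (row₁-bounded (standardPairs-sound a b p∈))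

weightSum-append₁ : ∀ a b m k → m ≡ a + b → b ≤ a → weightSum (map (append₁ m) (standardPairs a b)) k
                   ≡ sum (map (λ p → (doubledCells p + lowerLeftCell b a) C k) (standardPairs a b))
weightSum-append₁ a b m k refl b≤a =
  trans (cong sum (sym (map-∘ (standardPairs a b))))
        (sum-map-cong-∈ (standardPairs a b) (λ p∈ → cong (_C k) (raised p∈)))
  where
  raised : ∀ {p} → p ∈ standardPairs a b → doubledCells (append₁ (a + b) p) ≡ doubledCells p + lowerLeftCell b a
  raised {xs , ys} p∈ with s@(shaped len₁ len₂ _) ← standardPairs-sound a b p∈ =
    trans (doubledCells-append₁ (a + b) xs ys (row₁-bounded s) (row₂-bounded s) (subst₂ _≤_ (sym len₂) (sym len₁) b≤a))
          (cong₂ (λ u v → doubledCells (xs , ys) + lowerLeftCell u v) len₂ len₁)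

coeff-zero : ∀ a k → coeff a 0 k ≡ 0 C k
coeff-zero zero    k = +-identityʳ _
coeff-zero (suc a) k = begin
  coeff (suc a) 0 k                                              ≡⟨ weightSum-append₁ a 0 a k (sym (+-identityʳ a)) z≤n ⟩
  sum (map (λ p → (doubledCells p + 0) C k) (standardPairs a 0)) ≡⟨ sum-map-cong-∈ (standardPairs a 0) (λ _ → cong (_C k) (+-identityʳ _)) ⟩
  coeff a 0 k                                                    ≡⟨ coeff-zero a k ⟩
  0 C k                                                          ∎
  where open ≡-Reasoning

weightSum-++ : ∀ L L′ k → weightSum (L ++ L′) k ≡ weightSum L k + weightSum L′ k
weightSum-++ L L′ k = trans (cong sum (map-++ _ L L′)) (sum-++ (map _ L) (map _ L′))

coeff-skew : ∀ a b k → a ≤ b → coeff (suc a) (suc b) k ≡ coeff (suc a) b k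
coeff-skew a b k a≤b rewrite <ᵇ-false⁺ a≤b =
  trans (cong (λ L → weightSum L k) (++-identityʳ (map (append₂ (a + suc b)) (standardPairs (suc a) b))))
        (weightSum-append₂ (suc a) b (a + suc b) k (+-suc a b))

coeff-suc-suc : ∀ a b k → b < a → coeff (suc a) (suc b) k
                ≡ coeff (suc a) b k + sum (map (λ p → (doubledCells p + lowerLeftCell (suc b) a) C k) (standardPairs a (suc b)))
coeff-suc-suc a b k b<a rewrite <ᵇ-true⁺ b<a =
  trans (weightSum-++ (map (append₂ (a + suc b)) (standardPairs (suc a) b)) _ k)
        (cong₂ _+_ (weightSum-append₂ (suc a) b (a + suc b) k (+-suc a b))
                   (weightSum-append₁ a (suc b) (a + suc b) k refl b<a))

coeff-pascal : ∀ a b k → suc b < a → coeff (suc a) (suc b) k ≡ coeff (suc a) b k + coeff a (suc b) k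
coeff-pascal a b k 1+b<a =
  trans (coeff-suc-suc a b k (<-trans (n<1+n b) 1+b<a))
        (cong (coeff (suc a) b k +_) (sum-map-cong-∈ (standardPairs a (suc b)) (λ _ → cong (_C k) no-corner)))
  where
  no-corner : ∀ {n} → n + lowerLeftCell (suc b) a ≡ n
  no-corner rewrite ≡ᵇ-false⁺ (<⇒≢ 1+b<a) = +-identityʳ _

coeff-corner : ∀ a k → coeff (suc (suc a)) (suc a) k
               ≡ coeff (suc (suc a)) a k + sum (map (λ p → suc (doubledCells p) C k) (standardPairs (suc a) (suc a)))
coeff-corner a k =
  trans (coeff-suc-suc (suc a) a k (n<1+n a))
        (cong (coeff (suc (suc a)) a k +_) (sum-map-cong-∈ (standardPairs (suc a) (suc a)) (λ _ → cong (_C k) corner)))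
  where
  corner : ∀ {n} → n + lowerLeftCell (suc a) (suc a) ≡ suc n
  corner rewrite ≡ᵇ-refl a = +-comm _ 1

weightSum-suc-zero : ∀ L → sum (map (λ p → suc (doubledCells p) C 0) L) ≡ weightSum L 0
weightSum-suc-zero L = sum-map-cong-∈ L (λ {p} _ → trans (nC0≡1 (suc (doubledCells p))) (sym (nC0≡1 (doubledCells p))))

weightSum-suc-suc : ∀ L j → sum (map (λ p → suc (doubledCells p) C suc j) L) ≡ weightSum L j + weightSum L (suc j)
weightSum-suc-suc L j =
  trans (sum-map-cong-∈ L (λ {p} _ → sym (nCk+nC[k+1]≡[n+1]C[k+1] (doubledCells p) j)))
        (sum-map-+ (λ p → doubledCells p C j) (λ p → doubledCells p C suc j) L)

below : ℕ → ℕ → ℕ → ℕ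
below n k v = if k <ᵇ n then v else 0

Σₚ<-mono : ∀ (g : ℕ → ℕ) n k → Σₚ< n (λ i → mono (g i) i) k ≡ below n k (g k)
Σₚ<-mono g zero    k = refl
Σₚ<-mono g (suc n) k = trans (cong (_+ mono (g n) n k) (Σₚ<-mono g n k)) (step (<-cmp k n))
  where
  step : Tri (k < n) (k ≡ n) (n < k) → below n k (g k) + mono (g n) n k ≡ below (suc n) k (g k)
  step (tri< k<n _ _) rewrite <ᵇ-true⁺ k<n | ≡ᵇ-false⁺ (<⇒≢ k<n) | <ᵇ-true⁺ (m<n⇒m<1+n k<n) = +-identityʳ _
  step (tri≈ _ refl _) rewrite <ᵇ-false⁺ (≤-refl {k}) | ≡ᵇ-refl k | <ᵇ-true⁺ (n<1+n k) = refl
  step (tri> _ _ n<k) rewrite <ᵇ-false⁺ (<⇒≤ n<k) | ≡ᵇ-false⁺ (<⇒≢ n<k ∘ sym) | <ᵇ-false⁺ n<k = refl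

count-pascal-below : ∀ c b k → b ∸ k < c →
  below (suc b) k (count (suc (suc c)) (b ∸ k)) + below (suc (suc b)) k (count (suc c) (suc b ∸ k))
  ≡ below (suc (suc b)) k (count (suc (suc c)) (suc b ∸ k))
count-pascal-below c b       zero          b<c = sym (count-pascal (suc c) b (m<n⇒m<1+n b<c))
count-pascal-below c zero    (suc zero)    _   = trans (count-zero (suc c)) (sym (count-zero (suc (suc c))))
count-pascal-below c zero    (suc (suc k)) _   = refl
count-pascal-below c (suc b) (suc k)       b<c = count-pascal-below c b k b<c

count-corner : ∀ a → count (suc (suc a)) a + count (suc a) a ≡ count (suc (suc a)) (suc a)
count-corner a = sym (begin
  count (suc (suc a)) (suc a)                     ≡⟨ count-pascal (suc a) a (n<1+n a) ⟩
  count (suc (suc a)) a + count (suc a) (suc a)   ≡⟨ cong (count (suc (suc a)) a +_) (count-skew a a ≤-refl) ⟩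
  count (suc (suc a)) a + count (suc a) a         ∎)
  where open ≡-Reasoning

count-pascal²-below : ∀ c e j → e ≤ c →
  below e j (count (3 + c) (e ∸ suc j)) + (below (suc e) j (count (suc c) (e ∸ j)) + below e j (count (2 + c) (e ∸ suc j)))
  ≡ below (suc e) j (count (3 + c) (e ∸ j))
count-pascal²-below c zero    zero    _   =
  trans (+-identityʳ (count (suc c) 0)) (trans (count-zero (suc c)) (sym (count-zero (3 + c))))
count-pascal²-below c (suc e) zero    e<c = begin
  count (3 + c) e + (count (suc c) (suc e) + count (2 + c) e)  ≡⟨ cong (count (3 + c) e +_) (+-comm (count (suc c) (suc e)) _) ⟩
  count (3 + c) e + (count (2 + c) e + count (suc c) (suc e))  ≡⟨ cong (count (3 + c) e +_) (count-pascal (suc c) e (m<n⇒m<1+n e<c)) ⟨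
  count (3 + c) e + count (2 + c) (suc e)                      ≡⟨ count-pascal (2 + c) e (m<n⇒m<1+n (m<n⇒m<1+n e<c)) ⟨
  count (3 + c) (suc e)                                        ∎
  where open ≡-Reasoning
count-pascal²-below c zero    (suc j) _   = refl
count-pascal²-below c (suc e) (suc j) e<c = count-pascal²-below c e j (<⇒≤ e<c)

count-corner-below : ∀ a j →
  below (suc a) (suc j) (count (suc (suc a) + suc j) (a ∸ suc j))
  + (below (suc a) j (count (suc a + j) (a ∸ j)) + below (suc a) (suc j) (count (suc a + suc j) (a ∸ suc j)))
  ≡ below (suc (suc a)) (suc j) (count (suc (suc a) + suc j) (suc a ∸ suc j))
count-corner-below a j rewrite +-suc a j = count-pascal²-below (a + j) a j (m≤m+n a j)

ClosedForm : ℕ → ℕ → Set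
ClosedForm a b = ∀ k → coeff (suc a) b k ≡ below (suc b) k (count (suc a + k) (b ∸ k))

closedForm-zero : ∀ a → ClosedForm a zero
closedForm-zero a zero    = trans (coeff-zero (suc a) 0) (sym (count-zero (suc a + 0)))
closedForm-zero a (suc k) = coeff-zero (suc a) (suc k)

closedForm-pascal : ∀ a b → b < a → ClosedForm (suc a) b → ClosedForm a (suc b) → ClosedForm (suc a) (suc b)
closedForm-pascal a b b<a closed₂ closed₁ k = begin
  coeff (suc (suc a)) (suc b) k
    ≡⟨ coeff-pascal (suc a) b k (s≤s b<a) ⟩
  coeff (suc (suc a)) b k + coeff (suc a) (suc b) k
    ≡⟨ cong₂ _+_ (closed₂ k) (closed₁ k) ⟩
  below (suc b) k (count (suc (suc a) + k) (b ∸ k)) + below (suc (suc b)) k (count (suc a + k) (suc b ∸ k))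
    ≡⟨ count-pascal-below (a + k) b k (≤-<-trans (m∸n≤m b k) (<-≤-trans b<a (m≤m+n a k))) ⟩
  below (suc (suc b)) k (count (suc (suc a) + k) (suc b ∸ k))
    ∎
  where open ≡-Reasoning

closedForm-corner : ∀ a → ClosedForm (suc a) a → ClosedForm a a → ClosedForm (suc a) (suc a)
closedForm-corner a closed₂ closed₁ zero = begin
  coeff (suc (suc a)) (suc a) 0
    ≡⟨ coeff-corner a 0 ⟩
  coeff (suc (suc a)) a 0 + sum (map (λ p → suc (doubledCells p) C 0) (standardPairs (suc a) (suc a)))
    ≡⟨ cong (coeff (suc (suc a)) a 0 +_) (trans (weightSum-suc-zero (standardPairs (suc a) (suc a))) (coeff-skew a a 0 ≤-refl)) ⟩
  coeff (suc (suc a)) a 0 + coeff (suc a) a 0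
    ≡⟨ cong₂ _+_ (closed₂ 0) (closed₁ 0) ⟩
  count (suc (suc a) + 0) a + count (suc a + 0) a
    ≡⟨ subst (λ n → count (suc (suc n)) a + count (suc n) a ≡ count (suc (suc n)) (suc a)) (sym (+-identityʳ a)) (count-corner a) ⟩
  count (suc (suc a) + 0) (suc a)
    ∎
  where open ≡-Reasoning
closedForm-corner a closed₂ closed₁ (suc j) = begin
  coeff (suc (suc a)) (suc a) (suc j)
    ≡⟨ coeff-corner a (suc j) ⟩
  coeff (suc (suc a)) a (suc j) + sum (map (λ p → suc (doubledCells p) C suc j) (standardPairs (suc a) (suc a)))
    ≡⟨ cong (coeff (suc (suc a)) a (suc j) +_) (weightSum-suc-suc (standardPairs (suc a) (suc a)) j) ⟩
  coeff (suc (suc a)) a (suc j) + (coeff (suc a) (suc a) j + coeff (suc a) (suc a) (suc j))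
    ≡⟨ cong (λ n → coeff (suc (suc a)) a (suc j) + n) (cong₂ _+_ (coeff-skew a a j ≤-refl) (coeff-skew a a (suc j) ≤-refl)) ⟩
  coeff (suc (suc a)) a (suc j) + (coeff (suc a) a j + coeff (suc a) a (suc j))
    ≡⟨ cong₂ _+_ (closed₂ (suc j)) (cong₂ _+_ (closed₁ j) (closed₁ (suc j))) ⟩
  below (suc a) (suc j) (count (suc (suc a) + suc j) (a ∸ suc j))
  + (below (suc a) j (count (suc a + j) (a ∸ j)) + below (suc a) (suc j) (count (suc a + suc j) (a ∸ suc j)))
    ≡⟨ count-corner-below a j ⟩
  below (suc (suc a)) (suc j) (count (suc (suc a) + suc j) (suc a ∸ suc j))
    ∎
  where open ≡-Reasoning

closedForm : ∀ a b → b ≤ a → ClosedForm a b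
closedForm a       zero    _         = closedForm-zero a
closedForm (suc a) (suc b) (s≤s b≤a) with m≤n⇒m<n∨m≡n b≤a
... | inj₁ b<a  = closedForm-pascal a b b<a (closedForm (suc a) b (m≤n⇒m≤1+n b≤a)) (closedForm a (suc b) b<a)
... | inj₂ refl = closedForm-corner a (closedForm (suc a) a (n≤1+n a)) (closedForm a a ≤-refl)

bpoly-closedForm : ∀ a b k → b ≤ a → bpoly (suc a) b k ≡ Σₚ< (suc b) (λ i → mono (f (suc a + i) (b ∸ i)) i) k
bpoly-closedForm a b k b≤a = begin
  bpoly (suc a) b k                                        ≡⟨ bpoly≡coeff (suc a) b k ⟩
  coeff (suc a) b k                                        ≡⟨ closedForm a b b≤a k ⟩
  below (suc b) k (count (suc a + k) (b ∸ k))              ≡⟨ cong (below (suc b) k) (f≡count (suc a + k) (b ∸ k)) ⟨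
  below (suc b) k (f (suc a + k) (b ∸ k))                  ≡⟨ Σₚ<-mono (λ i → f (suc a + i) (b ∸ i)) (suc b) k ⟨
  Σₚ< (suc b) (λ i → mono (f (suc a + i) (b ∸ i)) i) k     ∎
  where open ≡-Reasoning

bpoly-diagonal : ∀ a k → bpoly (suc a) (suc a) k ≡ bpoly (suc a) a k
bpoly-diagonal a k = begin
  bpoly (suc a) (suc a) k  ≡⟨ bpoly≡coeff (suc a) (suc a) k ⟩
  coeff (suc a) (suc a) k  ≡⟨ coeff-skew a a k ≤-refl ⟩
  coeff (suc a) a k        ≡⟨ bpoly≡coeff (suc a) a k ⟨
  bpoly (suc a) a k        ∎
  where open ≡-Reasoning

theorem3p21 : (r s : ℕ) → s ≤ r → 1 ≤ r →
    (s < r → ∀ k → bpoly r s k ≡ Σₚ< (suc s) (λ i → mono (f (r + i) (s ∸ i)) i) k)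
    × (r ≡ s → ∀ k → bpoly r s k ≡ Σₚ< s (λ i → mono (f (r + i) (s ∸ 1 ∸ i)) i) k)
theorem3p21 (suc a) s _ _ = strict , diagonal
  where
  strict : s < suc a → ∀ k → bpoly (suc a) s k ≡ Σₚ< (suc s) (λ i → mono (f (suc a + i) (s ∸ i)) i) k
  strict s<r k = bpoly-closedForm a s k (≤-pred s<r)
  diagonal : suc a ≡ s → ∀ k → bpoly (suc a) s k ≡ Σₚ< s (λ i → mono (f (suc a + i) (s ∸ 1 ∸ i)) i) k
  diagonal refl k = trans (bpoly-diagonal a k) (bpoly-closedForm a a k ≤-refl)
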